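{- Let $P$ be an integer and $m\ge 0$ an integer, and let $\sigma_2(n)=\sum_{d\mid n} d^2$ (sum over positive divisors). Then, apart from finitely many (computable) solutions, all of which satisfy $n\le \big(|V_{2m}(P,-1)|+U_{2m}^2(P,-1)+1\big)^3$, every positive integer solution $n$ of $$\sigma_2(n)-n^2=V_{2m}(P,-1)\,n+U_{2m}^2(P,-1)+1$$ is of one of the following forms: (1) $n=U_{2k}(P,-1)\,U_{2k+2m}(P,-1)$ for some integer $k\ge 0$, with $U_{2k}(P,-1)$ and $U_{2k+2m}(P,-1)$ both primes; (2) $n=U_{2k}(P,-1)\,U_{2m-2k}(P,-1)$ for some integer $k\ge 0$ with $2m-2k\ge 0$ and $m\neq 2k$, with $U_{2k}(P,-1)$ and $U_{2m-2k}(P,-1)$ both primes.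
   Context: For integers $P,Q$, the Lucas sequence of the first kind is defined by $U_0(P,Q)=0$, $U_1(P,Q)=1$, $U_n(P,Q)=P\,U_{n-1}(P,Q)-Q\,U_{n-2}(P,Q)$ for $n>1$. The Lucas sequence of the second kind is $V_0(P,Q)=2$, $V_1(P,Q)=P$, $V_n(P,Q)=P\,V_{n-1}(P,Q)-Q\,V_{n-2}(P,Q)$ for $n>1$. -}

module Defs where

open import Data.Nat using (ℕ; zero; suc; _*_)
open import Data.Nat.Divisibility using (_∣?_)
open import Data.List using (List; upTo; map; filter)
open import Data.Nat.ListAction using (sum)
open import Data.Integer using (ℤ; +_; -_; _-_) renaming (_*_ to _*ℤ_)

U : ℤ → ℤ → ℕ → ℤ
U P Q zero = + 0
U P Q (suc zero) = + 1
U P Q (suc (suc n)) = P *ℤ U P Q (suc n) - Q *ℤ U P Q n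

V : ℤ → ℤ → ℕ → ℤ
V P Q zero = + 2
V P Q (suc zero) = P
V P Q (suc (suc n)) = P *ℤ V P Q (suc n) - Q *ℤ V P Q n

divisors : ℕ → List ℕ
divisors n = filter (λ d → d ∣? n) (map suc (upTo n))

σ₂ : ℕ → ℕ
σ₂ n = sum (map (λ d → d * d) (divisors n))

U⁻ : ℤ → ℕ → ℤ
U⁻ P n = U P (- + 1) n

V⁻ : ℤ → ℕ → ℤ
V⁻ P n = V P (- + 1) n

-- With p = |P|, the even-indexed terms U₂ⱼ(P, −1) and V₂ⱼ(P, −1) are ±U₂ⱼ(p, −1) and
-- V₂ⱼ(p, −1), so everything reduces to the natural-number sequences u = U(p, −1), v = V(p, −1).
-- Put a = v₂ₘ, c = u₂ₘ² and K = a + c + 1. If n has at least three prime factors and x is the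
-- least of three of them, n = x e, then σ₂ n ≥ n² + e² gives e² ≤ K n, hence e ≤ K x, and x² ≤ e
-- gives x ≤ K, so n ≤ K³. A prime or the square of a prime is never a solution, so otherwise
-- n = x y with distinct primes and x² + y² = a x y + c. As a² − 4 = (p² + 4) u₂ₘ², the
-- discriminant of this quadratic in y is u₂ₘ² w² with w² = (p² + 4) x² + 4, and a descent
-- (Vieta jumping) on the Cassini identity shows x = u₂ⱼ and w = v₂ⱼ. The addition formulas then
-- identify y as u₂ⱼ₊₂ₘ or, for the other root, (x, y) as (u₂ₖ₊₂ₘ, u₂ₖ): both are of the first
-- form.

module Submission where

module Nonnegative where

  open import Defs using (σ₂; divisors)
  open import Data.Empty using (⊥-elim)
  open import Data.List using ([]; _∷_; _++_; map; upTo)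
  open import Data.List.Membership.Propositional using (_∈_)
  open import Data.List.Membership.Propositional.Properties using (∈-∃++; ∈-filter⁺; ∈-filter⁻; ∈-map⁺; ∈-upTo⁺)
  open import Data.List.Relation.Binary.Permutation.Propositional.Properties using (shift; ∈-resp-↭) renaming (map⁺ to ↭-map⁺)
  open import Data.List.Relation.Binary.Subset.Propositional using (_⊆_)
  open import Data.List.Relation.Unary.All using (All; []; _∷_) renaming (lookup to All-lookup)
  open import Data.List.Relation.Unary.AllPairs using ([]; _∷_)
  open import Data.List.Relation.Unary.Any using (here; there)
  open import Data.List.Relation.Unary.Unique.Propositional using (Unique)
  import Data.List.Relation.Unary.Unique.Propositional.Properties as Unique
  open import Data.Nat
  open import Data.Nat.Coprimality using (Coprime; coprime-/gcd; coprime-divisor)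
  open import Data.Nat.DivMod using (_/_; m/n*n≡m)
  open import Data.Nat.Divisibility using (_∣_; _∣?_; divides; ∣-refl; ∣-trans; m∣m*n; n∣m*n; *-cancelʳ-∣; ∣⇒≤)
  open import Data.Nat.GCD using (gcd; gcd[m,n]∣m; gcd[m,n]∣n; gcd[m,n]≢0)
  open import Data.Nat.ListAction using (sum; product)
  open import Data.Nat.ListAction.Properties using (sum-↭)
  open import Data.Nat.Primality using (Prime; prime⇒nonTrivial; prime⇒nonZero; prime⇒irreducible; euclidsLemma; productOfPrimes≢0)
  open import Data.Nat.Primality.Factorisation using (factorise; PrimeFactorisation)
  open import Data.Nat.Properties
  open import Data.Nat.Tactic.RingSolver using (solve-∀)
  open import Data.Product using (∃; ∃₂; _×_; _,_; proj₂)
  open import Data.Sum using (_⊎_; inj₁; inj₂; [_,_]′) renaming (map to ⊎-map)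
  open import Function using (_∘_)
  open import Relation.Binary.PropositionalEquality hiding ([_])
  open import Relation.Nullary using (¬_; yes; no)

  -- To derive L ≡ R from X ≡ Y it suffices to check the polynomial identity L + X ≡ R + Y.
  cancel-using : ∀ {L R X Y} → L + X ≡ R + Y → X ≡ Y → L ≡ R
  cancel-using {L} {R} {X} e refl = +-cancelʳ-≡ X L R e

  m<m+n+1 : ∀ m n → m < m + n + 1
  m<m+n+1 m n = subst (m <_) (+-comm 1 (m + n)) (s≤s (m≤m+n m n))

  even-or-odd : ∀ r → ∃ λ s → r ≡ 2 * s ⊎ r ≡ suc (2 * s)
  even-or-odd zero = 0 , inj₁ refl
  even-or-odd (suc r) with even-or-odd r
  ... | s , inj₁ refl = s , inj₂ refl
  ... | s , inj₂ refl = suc s , inj₁ (identity s)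
    where
    identity : ∀ s → suc (suc (2 * s)) ≡ 2 * suc s
    identity = solve-∀

  distance : ∀ A B → ∃ λ g → (B ≡ A + g ⊎ A ≡ B + g) × g * g + 2 * (A * B) ≡ A * A + B * B
  distance A B with ≤-total A B
  ... | inj₁ A≤B with m≤n⇒∃[o]m+o≡n A≤B
  ...   | g , refl = g , inj₁ refl , identity A g
    where
    identity : ∀ A g → g * g + 2 * (A * (A + g)) ≡ A * A + (A + g) * (A + g)
    identity = solve-∀
  distance A B | inj₂ B≤A with m≤n⇒∃[o]m+o≡n B≤A
  ...   | g , refl = g , inj₂ refl , identity B g
    where
    identity : ∀ B g → g * g + 2 * ((B + g) * B) ≡ (B + g) * (B + g) + B * B
    identity = solve-∀

  m*m≡0⇒m≡0 : ∀ m → m * m ≡ 0 → m ≡ 0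
  m*m≡0⇒m≡0 zero _ = refl

  x²+y²≡2xy⇒x≡y : ∀ x y → x * x + y * y ≡ 2 * (x * y) → x ≡ y
  x²+y²≡2xy⇒x≡y x y h with distance x y
  ... | g , x≷y , g²+2xy≡x²+y² =
    from-≷ (m*m≡0⇒m≡0 g (+-cancelʳ-≡ (2 * (x * y)) (g * g) 0 (trans g²+2xy≡x²+y² h))) x≷y
    where
    from-≷ : ∀ {g} → g ≡ 0 → y ≡ x + g ⊎ x ≡ y + g → x ≡ y
    from-≷ refl (inj₁ y≡x+0) = sym (trans y≡x+0 (+-identityʳ x))
    from-≷ refl (inj₂ x≡y+0) = trans x≡y+0 (+-identityʳ y)

  m*m≡4⇒m≡2 : ∀ m → m * m ≡ 4 → m ≡ 2
  m*m≡4⇒m≡2 zero ()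
  m*m≡4⇒m≡2 (suc zero) ()
  m*m≡4⇒m≡2 (suc (suc zero)) _ = refl
  m*m≡4⇒m≡2 m@(suc (suc (suc _))) h = ⊥-elim (<⇒≱ (m<m+n 4 z<s) (subst (9 ≤_) h (*-mono-≤ 3≤m 3≤m)))
    where
    3≤m : 3 ≤ m
    3≤m = s≤s (s≤s (s≤s z≤n))

  m*m∣n*n⇒m∣n : ∀ m n → m * m ∣ n * n → m ∣ n
  m*m∣n*n⇒m∣n zero n (divides q n*n≡q*0) with m*n≡0⇒m≡0∨n≡0 n (trans n*n≡q*0 (*-zeroʳ q))
  ... | inj₁ refl = ∣-refl
  ... | inj₂ refl = ∣-refl
  m*m∣n*n⇒m∣n m@(suc _) n mm∣nn = subst (_∣ n) (sym m≡g) (gcd[m,n]∣n m n)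
    where
    g : ℕ
    g = gcd m n
    instance
      g≢0 : NonZero g
      g≢0 = ≢-nonZero (gcd[m,n]≢0 m n (inj₁ λ ()))
      g*g≢0 : NonZero (g * g)
      g*g≢0 = m*n≢0 g g
    a b : ℕ
    a = m / g
    b = n / g
    a*g≡m : a * g ≡ m
    a*g≡m = m/n*n≡m (gcd[m,n]∣m m n)
    b*g≡n : b * g ≡ n
    b*g≡n = m/n*n≡m (gcd[m,n]∣n m n)
    coprime : Coprime a b
    coprime = coprime-/gcd m n
    aa∣bb : a * a ∣ b * b
    aa∣bb = *-cancelʳ-∣ (g * g) (subst₂ _∣_ (regroup a g) (regroup b g)
              (subst₂ (λ s t → s * s ∣ t * t) (sym a*g≡m) (sym b*g≡n) mm∣nn))
      where
      regroup : ∀ a g → a * g * (a * g) ≡ a * a * (g * g)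
      regroup = solve-∀
    a≡1 : a ≡ 1
    a≡1 = coprime (∣-refl , coprime-divisor coprime (∣-trans (m∣m*n a) aa∣bb))
    m≡g : m ≡ g
    m≡g = trans (sym a*g≡m) (trans (cong (_* g) a≡1) (*-identityˡ g))

  ⊓-closed : ∀ (P : ℕ → Set) {m n} → P m → P n → P (m ⊓ n)
  ⊓-closed P {m} {n} Pm Pn with ⊓-sel m n
  ... | inj₁ m⊓n≡m = subst P (sym m⊓n≡m) Pm
  ... | inj₂ m⊓n≡n = subst P (sym m⊓n≡n) Pn

  -- The Lucas sequences U(p, −1) and V(p, −1) over ℕ

  u : ℕ → ℕ → ℕ
  u p zero = 0
  u p (suc zero) = 1
  u p (suc (suc n)) = p * u p (suc n) + u p n

  v : ℕ → ℕ → ℕ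
  v p zero = 2
  v p (suc zero) = p
  v p (suc (suc n)) = p * v p (suc n) + v p n

  -- Even indices are written double j rather than 2 * j so that they unfold
  -- structurally: double (suc j) = suc (suc (double j)).
  double : ℕ → ℕ
  double zero = 0
  double (suc j) = suc (suc (double j))

  double≡2* : ∀ j → double j ≡ 2 * j
  double≡2* zero = refl
  double≡2* (suc j) = trans (cong (suc ∘ suc) (double≡2* j)) (identity j)
    where
    identity : ∀ j → suc (suc (2 * j)) ≡ 2 * suc j
    identity = solve-∀

  double-+ : ∀ a b → double (a + b) ≡ double a + double b
  double-+ zero b = refl
  double-+ (suc a) b = cong (suc ∘ suc) (double-+ a b)

  u-0-even : ∀ j → u 0 (double j) ≡ 0
  u-0-even zero = refl
  u-0-even (suc j) = u-0-even j

  module Identities (p : ℕ) where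

    v+pu≡2u : ∀ n → v p n + p * u p n ≡ 2 * u p (suc n)
    v+pu≡2u zero = cong (2 +_) (*-zeroʳ p)
    v+pu≡2u (suc zero) = identity p
      where
      identity : ∀ p → p + p * 1 ≡ 2 * (p * 1 + 0)
      identity = solve-∀
    v+pu≡2u (suc (suc n)) = begin
      (p * v p (suc n) + v p n) + p * (p * u p (suc n) + u p n)
        ≡⟨ regroup p _ _ _ _ ⟩
      p * (v p (suc n) + p * u p (suc n)) + (v p n + p * u p n)
        ≡⟨ cong₂ (λ a b → p * a + b) (v+pu≡2u (suc n)) (v+pu≡2u n) ⟩
      p * (2 * u p (suc (suc n))) + 2 * u p (suc n)
        ≡⟨ factor p _ _ ⟩
      2 * (p * u p (suc (suc n)) + u p (suc n)) ∎
      where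
      open ≡-Reasoning
      regroup : ∀ p a b c d → (p * a + b) + p * (p * c + d) ≡ p * (a + p * c) + (b + p * d)
      regroup = solve-∀
      factor : ∀ p a b → p * (2 * a) + 2 * b ≡ 2 * (p * a + b)
      factor = solve-∀

    cassini-even : ∀ j → u p (suc (double j)) * u p (suc (double j))
                       ≡ p * u p (double j) * u p (suc (double j)) + u p (double j) * u p (double j) + 1
    cassini-odd : ∀ j → u p (suc (suc (double j))) * u p (suc (suc (double j))) + 1
                      ≡ p * u p (suc (double j)) * u p (suc (suc (double j))) + u p (suc (double j)) * u p (suc (double j))
    cassini-even zero = identity p
      where
      identity : ∀ p → 1 * 1 ≡ p * 0 * 1 + 0 * 0 + 1
      identity = solve-∀
    cassini-even (suc j) = cancel-using (identity p (u p (suc (double j))) (u p (suc (suc (double j))))) (cassini-odd j)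
      where
      identity : ∀ p A B → (p * B + A) * (p * B + A) + (B * B + 1) ≡ p * B * (p * B + A) + B * B + 1 + (p * A * B + A * A)
      identity = solve-∀
    cassini-odd j = cancel-using (identity p (u p (double j)) (u p (suc (double j)))) (cassini-even j)
      where
      identity : ∀ p A B → (p * B + A) * (p * B + A) + 1 + B * B ≡ p * B * (p * B + A) + B * B + (p * A * B + A * A + 1)
      identity = solve-∀

    2≤v-even : ∀ j → 2 ≤ v p (double j)
    2≤v-even zero = ≤-refl
    2≤v-even (suc j) = ≤-trans (2≤v-even j) (m≤n+m _ _)

    v²-even : ∀ j → v p (double j) * v p (double j) ≡ (p * p + 4) * (u p (double j) * u p (double j)) + 4
    v²-even j = +-cancelʳ-≡ (2 * (q * (2 * B))) _ _ (begin
      V * V + 2 * (q * (2 * B))               ≡⟨ cong (λ t → V * V + 2 * (q * t)) (v+pu≡2u (double j)) ⟨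
      V * V + 2 * (q * (V + q))               ≡⟨ complete-square V q ⟩
      (V + q) * (V + q) + q * q               ≡⟨ cong (λ t → t * t + q * q) (v+pu≡2u (double j)) ⟩
      2 * B * (2 * B) + q * q                 ≡⟨ regroup₁ B q ⟩
      4 * (B * B) + q * q                     ≡⟨ cong (λ t → 4 * t + q * q) (cassini-even j) ⟩
      4 * (p * A * B + A * A + 1) + q * q     ≡⟨ regroup₂ p A B ⟩
      (p * p + 4) * (A * A) + 4 + 2 * (q * (2 * B)) ∎)
      where
      open ≡-Reasoning
      V A B q : ℕ
      V = v p (double j)
      A = u p (double j)
      B = u p (suc (double j))
      q = p * A
      complete-square : ∀ V q → V * V + 2 * (q * (V + q)) ≡ (V + q) * (V + q) + q * q
      complete-square = solve-∀
      regroup₁ : ∀ B q → 2 * B * (2 * B) + q * q ≡ 4 * (B * B) + q * q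
      regroup₁ = solve-∀
      regroup₂ : ∀ p A B → 4 * (p * A * B + A * A + 1) + p * A * (p * A) ≡ (p * p + 4) * (A * A) + 4 + 2 * (p * A * (2 * B))
      regroup₂ = solve-∀

    2u[r+s] : ∀ r s → 2 * u p (r + s) ≡ u p r * v p s + u p s * v p r
    2u[r+s] zero s = identity (u p s) (v p s)
      where
      identity : ∀ a b → 2 * a ≡ 0 * b + a * 2
      identity = solve-∀
    2u[r+s] (suc zero) s = trans (sym (v+pu≡2u s)) (identity p (u p s) (v p s))
      where
      identity : ∀ p a b → b + p * a ≡ 1 * b + a * p
      identity = solve-∀
    2u[r+s] (suc (suc r)) s = begin
      2 * (p * u p (suc (r + s)) + u p (r + s))
        ≡⟨ distrib p (u p (suc r + s)) (u p (r + s)) ⟩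
      p * (2 * u p (suc r + s)) + 2 * u p (r + s)
        ≡⟨ cong₂ (λ a b → p * a + b) (2u[r+s] (suc r) s) (2u[r+s] r s) ⟩
      p * (u p (suc r) * v p s + u p s * v p (suc r)) + (u p r * v p s + u p s * v p r)
        ≡⟨ regroup p (u p (suc r)) (v p s) (u p s) (v p (suc r)) (u p r) (v p r) ⟩
      (p * u p (suc r) + u p r) * v p s + u p s * (p * v p (suc r) + v p r) ∎
      where
      open ≡-Reasoning
      distrib : ∀ p a b → 2 * (p * a + b) ≡ p * (2 * a) + 2 * b
      distrib = solve-∀
      regroup : ∀ p a b c d e f → p * (a * b + c * d) + (e * b + c * f) ≡ (p * a + e) * b + c * (p * d + f)
      regroup = solve-∀

    u[t+2j]v[2j] : ∀ j t → u p (t + double j) * v p (double j) ≡ u p (double j) * v p (t + double j) + 2 * u p t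
    u[t+2j]v[2j] j zero = sym (+-identityʳ _)
    u[t+2j]v[2j] j (suc zero) = +-cancelʳ-≡ (B * (p * A)) _ _ (begin
      B * V₀ + B * (p * A)            ≡⟨ *-distribˡ-+ B V₀ (p * A) ⟨
      B * (V₀ + p * A)                ≡⟨ cong (B *_) (v+pu≡2u (double j)) ⟩
      B * (2 * B)                     ≡⟨ *-comm B (2 * B) ⟩
      2 * B * B                       ≡⟨ *-assoc 2 B B ⟩
      2 * (B * B)                     ≡⟨ cong (2 *_) (cassini-even j) ⟩
      2 * (p * A * B + A * A + 1)     ≡⟨ regroup₁ p A B ⟩
      A * (2 * (p * B + A)) + 2 * 1   ≡⟨ cong (λ t → A * t + 2 * 1) (v+pu≡2u (suc (double j))) ⟨
      A * (V₁ + p * B) + 2 * 1        ≡⟨ regroup₂ p A B V₁ ⟩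
      A * V₁ + 2 * 1 + B * (p * A)    ∎)
      where
      open ≡-Reasoning
      A B V₀ V₁ : ℕ
      A = u p (double j)
      B = u p (suc (double j))
      V₀ = v p (double j)
      V₁ = v p (suc (double j))
      regroup₁ : ∀ p A B → 2 * (p * A * B + A * A + 1) ≡ A * (2 * (p * B + A)) + 2 * 1
      regroup₁ = solve-∀
      regroup₂ : ∀ p A B V₁ → A * (V₁ + p * B) + 2 * 1 ≡ A * V₁ + 2 * 1 + B * (p * A)
      regroup₂ = solve-∀
    u[t+2j]v[2j] j (suc (suc t)) = begin
      (p * u p (suc t + e) + u p (t + e)) * v p e
        ≡⟨ distrib p (u p (suc t + e)) (u p (t + e)) (v p e) ⟩
      p * (u p (suc t + e) * v p e) + u p (t + e) * v p e
        ≡⟨ cong₂ (λ a b → p * a + b) (u[t+2j]v[2j] j (suc t)) (u[t+2j]v[2j] j t) ⟩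
      p * (u p e * v p (suc t + e) + 2 * u p (suc t)) + (u p e * v p (t + e) + 2 * u p t)
        ≡⟨ regroup p (u p e) (v p (suc t + e)) (u p (suc t)) (v p (t + e)) (u p t) ⟩
      u p e * (p * v p (suc t + e) + v p (t + e)) + 2 * (p * u p (suc t) + u p t) ∎
      where
      e : ℕ
      e = double j
      open ≡-Reasoning
      distrib : ∀ p a b c → (p * a + b) * c ≡ p * (a * c) + b * c
      distrib = solve-∀
      regroup : ∀ p a b c d e → p * (a * b + 2 * c) + (a * d + 2 * e) ≡ a * (p * b + d) + 2 * (p * c + e)
      regroup = solve-∀

  -- The quadratic equation x² + y² = V₂ₘ x y + U₂ₘ²

  module Descent (p : ℕ) (p≥1 : 1 ≤ p) where

    px<y : ∀ x y → y * y ≡ p * x * y + x * x + 1 → p * x < y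
    px<y x y h = *-cancelʳ-< y (p * x) y (subst (p * x * y <_) (sym h) (m<m+n+1 _ _))

    px≤y : ∀ x y → 1 ≤ x → 1 ≤ y → y * y + 1 ≡ p * x * y + x * x → p * x ≤ y
    px≤y x y x≥1 y≥1 h = ≮⇒≥ λ y<px → <⇒≱ (+-monoʳ-< (y * y) (+-mono-≤ y≥1 (*-mono-≤ x≥1 x≥1))) (begin
      y * y + (y + x * x)  ≡⟨ regroup y (x * x) ⟩
      suc y * y + x * x    ≤⟨ +-monoˡ-≤ (x * x) (*-monoˡ-≤ y y<px) ⟩
      p * x * y + x * x    ≡⟨ h ⟨
      y * y + 1            ∎)
      where
      open ≤-Reasoning
      regroup : ∀ y z → y * y + (y + z) ≡ suc y * y + z
      regroup = solve-∀

    shrinks : ∀ x r → 1 ≤ p * x → r + x < x + (p * x + r)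
    shrinks x r px≥1 = subst (r + x <_) (regroup r x (p * x)) (m<m+n (r + x) px≥1)
      where
      regroup : ∀ r x q → r + x + q ≡ x + (q + r)
      regroup = solve-∀

    -- Vieta jumping: (x, y) ↦ (y ∸ p x, x) exchanges the two Cassini equations and decreases x + y.
    descent-even : ∀ f x y → x + y < f → y * y ≡ p * x * y + x * x + 1 →
                   ∃ λ j → x ≡ u p (double j) × y ≡ u p (suc (double j))
    descent-odd : ∀ f x y → x + y < f → 1 ≤ y → y * y + 1 ≡ p * x * y + x * x →
                  ∃ λ j → x ≡ u p (suc (double j)) × y ≡ u p (suc (suc (double j)))
    descent-even f zero y _ h = 0 , refl , m*n≡1⇒m≡1 y y (trans h (identity p y))
      where
      identity : ∀ p y → p * 0 * y + 0 * 0 + 1 ≡ 1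
      identity = solve-∀
    descent-even (suc f) x@(suc _) y (s≤s x+y<f) h with m≤n⇒∃[o]m+o≡n (<⇒≤ (px<y x y h))
    ... | r , refl with descent-odd f r x (≤-trans (shrinks x r px≥1) x+y<f) (s≤s z≤n) h′
      where
      px≥1 : 1 ≤ p * x
      px≥1 = *-mono-≤ p≥1 (s≤s z≤n)
      h′ : x * x + 1 ≡ p * r * x + r * r
      h′ = cancel-using (identity p x r) h
        where
        identity : ∀ p x r → x * x + 1 + (p * x + r) * (p * x + r) ≡ p * r * x + r * r + (p * x * (p * x + r) + x * x + 1)
        identity = solve-∀
    ... | j , r≡ , x≡ = suc j , x≡ , cong₂ (λ a b → p * a + b) x≡ r≡
    descent-odd f zero y _ _ h = ⊥-elim (1+n≢0 (trans (+-comm 1 (y * y)) (trans h (identity p y))))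
      where
      identity : ∀ p y → p * 0 * y + 0 * 0 ≡ 0
      identity = solve-∀
    descent-odd (suc f) x@(suc _) y (s≤s x+y<f) y≥1 h with m≤n⇒∃[o]m+o≡n (px≤y x y (s≤s z≤n) y≥1 h)
    ... | r , refl with descent-even f r x (≤-trans (shrinks x r px≥1) x+y<f) h′
      where
      px≥1 : 1 ≤ p * x
      px≥1 = *-mono-≤ p≥1 (s≤s z≤n)
      h′ : x * x ≡ p * r * x + r * r + 1
      h′ = cancel-using (identity p x r) h
        where
        identity : ∀ p x r → x * x + ((p * x + r) * (p * x + r) + 1) ≡ p * r * x + r * r + 1 + (p * x * (p * x + r) + x * x)
        identity = solve-∀
    ... | j , r≡ , x≡ = j , x≡ , cong₂ (λ a b → p * a + b) x≡ r≡

    descent : ∀ x y → y * y ≡ p * x * y + x * x + 1 → ∃ λ j → x ≡ u p (double j) × y ≡ u p (suc (double j))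
    descent x y = descent-even (suc (x + y)) x y ≤-refl

  -- (w ∸ p x)(w + p x) = 4 (x² + 1) forces w ∸ p x to be even, and y = (w + p x) / 2.
  pell⇒cassini : ∀ p x w → w * w ≡ (p * p + 4) * (x * x) + 4 →
                 ∃ λ y → y * y ≡ p * x * y + x * x + 1 × w + p * x ≡ 2 * y
  pell⇒cassini p x w h with m≤n⇒∃[o]m+o≡n px≤w
    where
    px≤w : p * x ≤ w
    px≤w = ≮⇒≥ λ w<px → <⇒≱ (*-mono-< w<px w<px)
             (subst (p * x * (p * x) ≤_) (trans (sym (expand p x)) (sym h)) (m≤m+n _ _))
      where
      expand : ∀ p x → (p * p + 4) * (x * x) + 4 ≡ p * x * (p * x) + (4 * (x * x) + 4)
      expand = solve-∀
  ... | r , refl = from-difference (even-or-odd r)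
    where
    difference : r * (2 * (p * x) + r) ≡ 4 * (x * x + 1)
    difference = cancel-using (identity p x r) (sym h)
      where
      identity : ∀ p x r → r * (2 * (p * x) + r) + ((p * p + 4) * (x * x) + 4) ≡ 4 * (x * x + 1) + (p * x + r) * (p * x + r)
      identity = solve-∀
    from-difference : (∃ λ s → r ≡ 2 * s ⊎ r ≡ suc (2 * s)) →
                      ∃ λ y → y * y ≡ p * x * y + x * x + 1 × p * x + r + p * x ≡ 2 * y
    from-difference (s , inj₁ refl) =
      p * x + s , cancel-using (identity₁ (p * x) s (x * x)) (sym s[px+s]≡x²+1) , identity₂ (p * x) s
      where
      s[px+s]≡x²+1 : s * (p * x + s) ≡ x * x + 1
      s[px+s]≡x²+1 = *-cancelˡ-≡ _ _ 4 (trans (identity (p * x) s) difference)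
        where
        identity : ∀ q s → 4 * (s * (q + s)) ≡ 2 * s * (2 * q + 2 * s)
        identity = solve-∀
      identity₁ : ∀ q s z → (q + s) * (q + s) + (z + 1) ≡ q * (q + s) + z + 1 + s * (q + s)
      identity₁ = solve-∀
      identity₂ : ∀ q s → q + 2 * s + q ≡ 2 * (q + s)
      identity₂ = solve-∀
    from-difference (s , inj₂ refl) = ⊥-elim (even≢odd (2 * (x * x + 1)) (p * x * suc (2 * s) + 2 * s * s + 2 * s)
                                        (trans (double-4 (x * x + 1)) (trans (sym difference) (odd-product (p * x) s))))
      where
      double-4 : ∀ z → 2 * (2 * z) ≡ 4 * z
      double-4 = solve-∀
      odd-product : ∀ q s → suc (2 * s) * (2 * q + suc (2 * s)) ≡ suc (2 * (q * suc (2 * s) + 2 * s * s + 2 * s))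
      odd-product = solve-∀

  LucasPair : ℕ → ℕ → ℕ → ℕ → Set
  LucasPair p m x y = ∃ λ k → x ≡ u p (double k) × y ≡ u p (double k + double m)

  module Quadratic (p m x y : ℕ) (y≥1 : 1 ≤ y) (x≢y : x ≢ y)
                   (h : x * x + y * y ≡ v p (double m) * (x * y) + u p (double m) * u p (double m)) where

    open Identities p

    a U D : ℕ
    a = v p (double m)
    U = u p (double m)
    D = p * p + 4

    U≢0 : U ≢ 0
    U≢0 U≡0 = x≢y (x²+y²≡2xy⇒x≡y x y
                     (trans h (trans (cong₂ (λ s t → s * (x * y) + t * t) a≡2 U≡0) (+-identityʳ _))))
      where
      a≡2 : a ≡ 2
      a≡2 = m*m≡4⇒m≡2 a (trans (v²-even m) (trans (cong (λ t → D * (t * t) + 4) U≡0) (cong (_+ 4) (*-zeroʳ D))))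

    instance
      U*U≢0 : NonZero (U * U)
      U*U≢0 = m*n≢0 U U {{≢-nonZero U≢0}} {{≢-nonZero U≢0}}

    p≥1 : 1 ≤ p
    p≥1 = n≢0⇒n>0 λ { refl → U≢0 (u-0-even m) }

    discriminant : ∃ λ g → g * g ≡ (D * (x * x) + 4) * (U * U) × (2 * y ≡ a * x + g ⊎ a * x ≡ 2 * y + g)
    discriminant with distance (a * x) (2 * y)
    ... | g , ≷ , g²+4axy≡a²x²+4y² = g , +-cancelʳ-≡ (2 * (a * x * (2 * y))) _ _ (begin
      g * g + 2 * (a * x * (2 * y))                    ≡⟨ g²+4axy≡a²x²+4y² ⟩
      a * x * (a * x) + 2 * y * (2 * y)                ≡⟨ regroup₁ a x y ⟩
      a * a * (x * x) + 4 * (y * y)                    ≡⟨ cong (λ t → t * (x * x) + 4 * (y * y)) (v²-even m) ⟩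
      (D * (U * U) + 4) * (x * x) + 4 * (y * y)        ≡⟨ regroup₂ D U x y ⟩
      D * (U * U) * (x * x) + 4 * (x * x + y * y)      ≡⟨ cong (λ t → D * (U * U) * (x * x) + 4 * t) h ⟩
      D * (U * U) * (x * x) + 4 * (a * (x * y) + U * U) ≡⟨ regroup₃ D U a x y ⟩
      (D * (x * x) + 4) * (U * U) + 2 * (a * x * (2 * y)) ∎) , ≷
      where
      open ≡-Reasoning
      regroup₁ : ∀ a x y → a * x * (a * x) + 2 * y * (2 * y) ≡ a * a * (x * x) + 4 * (y * y)
      regroup₁ = solve-∀
      regroup₂ : ∀ D U x y → (D * (U * U) + 4) * (x * x) + 4 * (y * y) ≡ D * (U * U) * (x * x) + 4 * (x * x + y * y)
      regroup₂ = solve-∀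
      regroup₃ : ∀ D U a x y → D * (U * U) * (x * x) + 4 * (a * (x * y) + U * U)
                              ≡ (D * (x * x) + 4) * (U * U) + 2 * (a * x * (2 * y))
      regroup₃ = solve-∀

    pell : ∃ λ w → w * w ≡ D * (x * x) + 4 × (2 * y ≡ a * x + w * U ⊎ a * x ≡ 2 * y + w * U)
    pell with discriminant
    ... | g , g² , ≷ with m*m∣n*n⇒m∣n U g (divides (D * (x * x) + 4) g²)
    ...   | divides w refl = w , *-cancelʳ-≡ (w * w) _ (U * U) (trans (regroup w U) g²) , ≷
      where
      regroup : ∀ w U → w * w * (U * U) ≡ w * U * (w * U)
      regroup = solve-∀

    larger-root : ∀ j → x ≡ u p (double j) → 2 * y ≡ a * x + v p (double j) * U → LucasPair p m x y
    larger-root j x≡ e = j , x≡ , *-cancelˡ-≡ y _ 2 (begin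
      2 * y                                ≡⟨ e ⟩
      a * x + v p (double j) * U           ≡⟨ cong (λ t → a * t + v p (double j) * U) x≡ ⟩
      a * u p (double j) + v p (double j) * U ≡⟨ cong₂ _+_ (*-comm a _) (*-comm _ U) ⟩
      u p (double j) * a + U * v p (double j) ≡⟨ 2u[r+s] (double j) (double m) ⟨
      2 * u p (double j + double m)        ∎)
      where open ≡-Reasoning

    smaller-root : ∀ j → x ≡ u p (double j) → a * x ≡ 2 * y + v p (double j) * U → LucasPair p m y x
    smaller-root j x≡ e with m ≤? j
    ... | yes m≤j with m≤n⇒∃[o]m+o≡n m≤j
    ...   | k , refl = k , y≡ , x≡K
      where
      K : ℕ
      K = double k + double m
      m+k≡K : double (m + k) ≡ K
      m+k≡K = trans (double-+ m k) (+-comm (double m) (double k))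
      x≡K : x ≡ u p K
      x≡K = trans x≡ (cong (u p) m+k≡K)
      y≡ : y ≡ u p (double k)
      y≡ = *-cancelˡ-≡ y _ 2 (+-cancelʳ-≡ (U * v p K) (2 * y) (2 * u p (double k)) (begin
        2 * y + U * v p K                  ≡⟨ cong (2 * y +_) (*-comm U (v p K)) ⟩
        2 * y + v p K * U                  ≡⟨ cong (λ t → 2 * y + v p t * U) m+k≡K ⟨
        2 * y + v p (double (m + k)) * U   ≡⟨ e ⟨
        a * x                              ≡⟨ trans (cong (a *_) x≡K) (*-comm a (u p K)) ⟩
        u p K * a                          ≡⟨ u[t+2j]v[2j] m (double k) ⟩
        U * v p K + 2 * u p (double k)     ≡⟨ +-comm (U * v p K) _ ⟩
        2 * u p (double k) + U * v p K     ∎))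
        where open ≡-Reasoning
    -- For j < m the smaller root would be 2 y = −2 u₂₍ₘ₋ⱼ₎ < 0.
    smaller-root j x≡ e | no m≰j with m≤n⇒∃[o]m+o≡n (≰⇒> m≰j)
    ...   | t , j+1+t≡m = ⊥-elim (<-irrefl refl (begin-strict
      a * x                        <⟨ m<n+m (a * x) (m≤n⇒m≤o*n 2 y≥1) ⟩
      2 * y + a * x                ≤⟨ +-monoʳ-≤ (2 * y) ax≤vU ⟩
      2 * y + v p (double j) * U   ≡⟨ e ⟨
      a * x                        ∎))
      where
      open ≤-Reasoning
      m≡ : double m ≡ double (suc t) + double j
      m≡ = trans (cong double (trans (sym j+1+t≡m) (cong suc (+-comm j t)))) (double-+ (suc t) j)
      ax≤vU : a * x ≤ v p (double j) * U
      ax≤vU = begin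
        a * x                                    ≡⟨ *-comm a x ⟩
        x * a                                    ≤⟨ m≤m+n _ _ ⟩
        x * a + 2 * u p (double (suc t))         ≡⟨ cong₂ (λ s r → s * v p r + 2 * u p (double (suc t))) x≡ m≡ ⟩
        u p (double j) * v p (double (suc t) + double j) + 2 * u p (double (suc t))
                                                 ≡⟨ u[t+2j]v[2j] j (double (suc t)) ⟨
        u p (double (suc t) + double j) * v p (double j) ≡⟨ cong (λ r → u p r * v p (double j)) m≡ ⟨
        U * v p (double j)                       ≡⟨ *-comm U _ ⟩
        v p (double j) * U                       ∎

    lucas-pair : LucasPair p m x y ⊎ LucasPair p m y x
    lucas-pair with pell
    ... | w , w² , ≷ with pell⇒cassini p x w w²
    ...   | y′ , cassini , w+px≡2y′ with Descent.descent p p≥1 x y′ cassini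
    ...     | j , x≡ , y′≡ =
      ⊎-map (larger-root j x≡) (smaller-root j x≡) (subst (λ t → 2 * y ≡ a * x + t * U ⊎ a * x ≡ 2 * y + t * U) w≡ ≷)
      where
      w≡ : w ≡ v p (double j)
      w≡ = +-cancelʳ-≡ (p * x) w (v p (double j)) (begin
        w + p * x                        ≡⟨ w+px≡2y′ ⟩
        2 * y′                           ≡⟨ cong (2 *_) y′≡ ⟩
        2 * u p (suc (double j))         ≡⟨ v+pu≡2u (double j) ⟨
        v p (double j) + p * u p (double j) ≡⟨ cong (λ t → v p (double j) + p * t) x≡ ⟨
        v p (double j) + p * x           ∎)
        where open ≡-Reasoning

  -- Sums of squares of divisors

  sum-map-mono-⊆ : ∀ (f : ℕ → ℕ) {xs ys} → Unique xs → xs ⊆ ys → sum (map f xs) ≤ sum (map f ys)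
  sum-map-mono-⊆ f {[]} _ _ = z≤n
  sum-map-mono-⊆ f {x ∷ xs} (x∉xs ∷ unique) xs⊆ys with ∈-∃++ (xs⊆ys (here refl))
  ... | as , bs , refl = begin
    f x + sum (map f xs)             ≤⟨ +-monoʳ-≤ (f x) (sum-map-mono-⊆ f unique xs⊆as++bs) ⟩
    f x + sum (map f (as ++ bs))     ≡⟨ sum-↭ (↭-map⁺ f (shift x as bs)) ⟨
    sum (map f (as ++ x ∷ bs))       ∎
    where
    open ≤-Reasoning
    xs⊆as++bs : xs ⊆ as ++ bs
    xs⊆as++bs z∈xs with ∈-resp-↭ (shift x as bs) (xs⊆ys (there z∈xs))
    ... | here refl = ⊥-elim (All-lookup x∉xs z∈xs refl)
    ... | there z∈as++bs = z∈as++bs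

  ∈-divisors : ∀ {n d} → 0 < n → d ∣ n → d ∈ divisors n
  ∈-divisors {d = zero} n>0 (divides q n≡q*0) = ⊥-elim (<-irrefl (sym (trans n≡q*0 (*-zeroʳ q))) n>0)
  ∈-divisors {n} {suc d} n>0 d∣n = ∈-filter⁺ (_∣? n) (∈-map⁺ suc (∈-upTo⁺ (∣⇒≤ {{>-nonZero n>0}} d∣n))) d∣n

  unique-divisors : ∀ n → Unique (divisors n)
  unique-divisors n = Unique.filter⁺ (_∣? n) (Unique.map⁺ suc-injective (Unique.upTo⁺ n))

  σ₂-≥ : ∀ {n} xs → 0 < n → Unique xs → (∀ {d} → d ∈ xs → d ∣ n) → sum (map (λ d → d * d) xs) ≤ σ₂ n
  σ₂-≥ xs n>0 unique xs∣n = sum-map-mono-⊆ (λ d → d * d) unique (∈-divisors n>0 ∘ xs∣n)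

  σ₂-≤ : ∀ {n} xs → (∀ {d} → d ∣ n → d ∈ xs) → σ₂ n ≤ sum (map (λ d → d * d) xs)
  σ₂-≤ {n} xs ∣n⇒∈xs =
    sum-map-mono-⊆ (λ d → d * d) (unique-divisors n) (∣n⇒∈xs ∘ proj₂ ∘ ∈-filter⁻ (_∣? n) {xs = map suc (upTo n)})

  prime⇒1<p : ∀ {p} → Prime p → 1 < p
  prime⇒1<p {p} p-prime = nonTrivial⇒n>1 p {{prime⇒nonTrivial p-prime}}

  prime⇒0<p : ∀ {p} → Prime p → 0 < p
  prime⇒0<p = <-trans z<s ∘ prime⇒1<p

  p<p*q : ∀ {p q} → Prime p → Prime q → p < p * q
  p<p*q {p} {q} p-prime q-prime = m<m*n p q {{prime⇒nonZero p-prime}} (prime⇒1<p q-prime)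

  ∣p⇒∈ : ∀ {p d} → Prime p → d ∣ p → d ∈ 1 ∷ p ∷ []
  ∣p⇒∈ p-prime d∣p with prime⇒irreducible p-prime d∣p
  ... | inj₁ d≡1 = here d≡1
  ... | inj₂ d≡p = there (here d≡p)

  ∣p*q⇒∈ : ∀ {p q d} → Prime p → Prime q → d ∣ p * q → d ∈ 1 ∷ p ∷ q ∷ p * q ∷ []
  ∣p*q⇒∈ {p} {q} {d} p-prime q-prime (divides e pq≡ed) with euclidsLemma e d p-prime (subst (p ∣_) pq≡ed (m∣m*n q))
  ... | inj₁ (divides k refl)
    with ∣p⇒∈ q-prime (divides k (*-cancelˡ-≡ q (k * d) p {{prime⇒nonZero p-prime}} (trans pq≡ed (regroup k p d))))
    where
    regroup : ∀ k p d → k * p * d ≡ p * (k * d)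
    regroup = solve-∀
  ...   | here d≡1 = here d≡1
  ...   | there (here d≡q) = there (there (here d≡q))
  ∣p*q⇒∈ {p} {q} p-prime q-prime (divides e pq≡ed) | inj₂ (divides k refl)
    with ∣p⇒∈ q-prime (divides e (*-cancelˡ-≡ q (e * k) p {{prime⇒nonZero p-prime}} (trans pq≡ed (regroup e k p))))
    where
    regroup : ∀ e k p → e * (k * p) ≡ p * (e * k)
    regroup = solve-∀
  ...   | here refl = there (here (*-identityˡ p))
  ...   | there (here refl) = there (there (there (here (*-comm q p))))

  module σ₂-Equation (a c : ℕ) (a≥2 : 2 ≤ a) where

    Solution : ℕ → Set
    Solution n = σ₂ n ≡ n * n + a * n + c + 1

    bound : ℕ
    bound = (a + c + 1) ^ 3

    ¬prime-solution : ∀ {p} → Prime p → ¬ Solution p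
    ¬prime-solution {p} p-prime h =
      <⇒≱ σ₂-bound<rhs (subst (_≤ 1 + (p * p + 0)) h (σ₂-≤ (1 ∷ p ∷ []) (∣p⇒∈ p-prime)))
      where
      σ₂-bound<rhs : 1 + (p * p + 0) < p * p + a * p + c + 1
      σ₂-bound<rhs = subst (1 + (p * p + 0) <_) (regroup p (a * p) c)
                       (m<m+n _ (≤-trans (*-mono-≤ (<-≤-trans z<s a≥2) (prime⇒0<p p-prime)) (m≤m+n (a * p) c)))
        where
        regroup : ∀ p q c → 1 + (p * p + 0) + (q + c) ≡ p * p + q + c + 1
        regroup = solve-∀

    ¬prime²-solution : ∀ {p} → Prime p → ¬ Solution (p * p)
    ¬prime²-solution {p} p-prime h =
      <⇒≱ σ₂-bound<rhs (subst (_≤ 1 + (P + (P * P + 0))) h (σ₂-≤ (1 ∷ p ∷ P ∷ []) ∣P⇒∈))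
      where
      P : ℕ
      P = p * p
      ∣P⇒∈ : ∀ {d} → d ∣ P → d ∈ 1 ∷ p ∷ P ∷ []
      ∣P⇒∈ d∣P with ∣p*q⇒∈ p-prime p-prime d∣P
      ... | here d≡1 = here d≡1
      ... | there (here d≡p) = there (here d≡p)
      ... | there (there (here d≡p)) = there (here d≡p)
      ... | there (there (there d∈)) = there (there d∈)
      σ₂-bound<rhs : 1 + (P + (P * P + 0)) < P * P + a * P + c + 1
      σ₂-bound<rhs = begin-strict
        1 + (P + (P * P + 0))   <⟨ m<m+n _ (*-mono-< (prime⇒0<p p-prime) (prime⇒0<p p-prime)) ⟩
        1 + (P + (P * P + 0)) + P ≡⟨ regroup P ⟩
        P * P + 2 * P + 1        ≤⟨ +-monoˡ-≤ 1 (≤-trans (+-monoʳ-≤ (P * P) (*-monoˡ-≤ P a≥2)) (m≤m+n _ c)) ⟩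
        P * P + a * P + c + 1    ∎
        where
        open ≤-Reasoning
        regroup : ∀ P → 1 + (P + (P * P + 0)) + P ≡ P * P + 2 * P + 1
        regroup = solve-∀

    semiprime-solution : ∀ {p q} → Prime p → Prime q → p ≢ q → Solution (p * q) → p * p + q * q ≡ a * (p * q) + c
    semiprime-solution {p} {q} p-prime q-prime p≢q h =
      +-cancelˡ-≡ (p * q * (p * q) + 1) _ _ (trans (regroup₁ p q) (trans (sym σ₂[pq]) (trans h (regroup₂ (p * q) a c))))
      where
      PQ : ℕ
      PQ = p * q
      σ₂[pq] : σ₂ PQ ≡ 1 * 1 + (p * p + (q * q + (PQ * PQ + 0)))
      σ₂[pq] = ≤-antisym (σ₂-≤ (1 ∷ p ∷ q ∷ PQ ∷ []) (∣p*q⇒∈ p-prime q-prime))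
                         (σ₂-≥ (1 ∷ p ∷ q ∷ PQ ∷ []) (*-mono-< (prime⇒0<p p-prime) (prime⇒0<p q-prime)) unique ∈⇒∣)
        where
        1<pq : 1 < PQ
        1<pq = <-trans (prime⇒1<p p-prime) (p<p*q p-prime q-prime)
        q<pq : q < PQ
        q<pq = subst (q <_) (*-comm q p) (p<p*q q-prime p-prime)
        unique : Unique (1 ∷ p ∷ q ∷ PQ ∷ [])
        unique = (<⇒≢ (prime⇒1<p p-prime) ∷ <⇒≢ (prime⇒1<p q-prime) ∷ <⇒≢ 1<pq ∷ [])
               ∷ (p≢q ∷ <⇒≢ (p<p*q p-prime q-prime) ∷ [])
               ∷ (<⇒≢ q<pq ∷ []) ∷ [] ∷ []
        ∈⇒∣ : ∀ {d} → d ∈ 1 ∷ p ∷ q ∷ PQ ∷ [] → d ∣ PQ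
        ∈⇒∣ (here refl) = divides PQ (sym (*-identityʳ PQ))
        ∈⇒∣ (there (here refl)) = m∣m*n q
        ∈⇒∣ (there (there (here refl))) = n∣m*n p
        ∈⇒∣ (there (there (there (here refl)))) = ∣-refl
      regroup₁ : ∀ p q → p * q * (p * q) + 1 + (p * p + q * q) ≡ 1 * 1 + (p * p + (q * q + (p * q * (p * q) + 0)))
      regroup₁ = solve-∀
      regroup₂ : ∀ n a c → n * n + a * n + c + 1 ≡ n * n + 1 + (a * n + c)
      regroup₂ = solve-∀

    bounded-by-cube : ∀ {n x} → x ∣ n → 2 ≤ x → x * (x * x) ≤ n → Solution n → n ≤ bound
    bounded-by-cube {n} {x} (divides e refl) x≥2 x³≤n h = begin
      e * x           ≤⟨ *-monoˡ-≤ x e≤Kx ⟩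
      K * x * x       ≤⟨ *-monoˡ-≤ x (*-monoʳ-≤ K x≤K) ⟩
      K * K * x       ≤⟨ *-monoʳ-≤ (K * K) x≤K ⟩
      K * K * K       ≡⟨ cube K ⟩
      bound           ∎
      where
      open ≤-Reasoning
      K : ℕ
      K = a + c + 1
      x>0 : 0 < x
      x>0 = <-≤-trans z<s x≥2
      n>0 : 0 < n
      n>0 = <-≤-trans (*-mono-< x>0 (*-mono-< x>0 x>0)) x³≤n
      instance
        e≢0 : NonZero e
        e≢0 = m*n≢0⇒m≢0 e {{>-nonZero n>0}}
        x≢0 : NonZero x
        x≢0 = >-nonZero x>0
      e<n : e < n
      e<n = <-≤-trans (m<m+n e (>-nonZero⁻¹ e))
              (subst (e + e ≤_) (*-comm x e) (subst (_≤ x * e) (double-e e) (*-monoˡ-≤ e x≥2)))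
        where
        double-e : ∀ e → 2 * e ≡ e + e
        double-e = solve-∀
      e²≤an+c+1 : e * e ≤ a * n + c + 1
      e²≤an+c+1 = +-cancelˡ-≤ (n * n) _ _ (subst₂ _≤_ (regroup₁ e n) (trans h (regroup₂ n a c))
                    (σ₂-≥ (e ∷ n ∷ []) n>0 ((<⇒≢ e<n ∷ []) ∷ [] ∷ []) ∈⇒∣))
        where
        ∈⇒∣ : ∀ {d} → d ∈ e ∷ n ∷ [] → d ∣ n
        ∈⇒∣ (here refl) = divides x (*-comm e x)
        ∈⇒∣ (there (here refl)) = ∣-refl
        regroup₁ : ∀ e n → e * e + (n * n + 0) ≡ n * n + e * e
        regroup₁ = solve-∀
        regroup₂ : ∀ n a c → n * n + a * n + c + 1 ≡ n * n + (a * n + c + 1)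
        regroup₂ = solve-∀
      e≤Kx : e ≤ K * x
      e≤Kx = *-cancelʳ-≤ e (K * x) e (begin
        e * e            ≤⟨ e²≤an+c+1 ⟩
        a * n + c + 1    ≤⟨ +-monoˡ-≤ 1 (+-monoʳ-≤ (a * n) (m≤m*n c n {{>-nonZero n>0}})) ⟩
        a * n + c * n + 1 ≤⟨ +-monoʳ-≤ (a * n + c * n) n>0 ⟩
        a * n + c * n + n ≡⟨ regroup a c e x ⟩
        K * x * e        ∎)
        where
        regroup : ∀ a c e x → a * (e * x) + c * (e * x) + e * x ≡ (a + c + 1) * x * e
        regroup = solve-∀
      x²≤e : x * x ≤ e
      x²≤e = *-cancelʳ-≤ (x * x) e x (≤-trans (≤-reflexive (regroup x)) x³≤n)
        where
        regroup : ∀ x → x * x * x ≡ x * (x * x)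
        regroup = solve-∀
      x≤K : x ≤ K
      x≤K = *-cancelʳ-≤ x K x (≤-trans x²≤e e≤Kx)
      cube : ∀ K → K * K * K ≡ K ^ 3
      cube K = trans (*-assoc K K K) (cong (λ t → K * (K * t)) (sym (*-identityʳ K)))

    SemiprimeSolution : ℕ → Set
    SemiprimeSolution n = ∃₂ λ p q → Prime p × Prime q × p ≢ q × n ≡ p * q × p * p + q * q ≡ a * (p * q) + c

    classify-factors : ∀ {n} fs → n ≡ product fs → All Prime fs → Solution n → n ≤ bound ⊎ SemiprimeSolution n
    classify-factors [] refl _ _ = inj₁ (≤-trans (s≤s z≤n) (^-monoˡ-≤ 3 (m≤n+m 1 (a + c))))
    classify-factors (p ∷ []) refl (p-prime ∷ []) h = ⊥-elim (¬prime-solution p-prime (subst Solution (*-identityʳ p) h))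
    classify-factors (p ∷ q ∷ []) refl (p-prime ∷ q-prime ∷ []) h with p ≟ q
    ... | yes refl = ⊥-elim (¬prime²-solution p-prime (subst Solution (cong (p *_) (*-identityʳ p)) h))
    ... | no p≢q = inj₂ (p , q , p-prime , q-prime , p≢q , pq≡ , semiprime-solution p-prime q-prime p≢q (subst Solution pq≡ h))
      where
      pq≡ : p * (q * 1) ≡ p * q
      pq≡ = cong (p *_) (*-identityʳ q)
    classify-factors (p ∷ q ∷ r ∷ fs) refl (p-prime ∷ q-prime ∷ r-prime ∷ fs-prime) h =
      inj₁ (bounded-by-cube x∣n 2≤x x³≤n h)
      where
      t x : ℕ
      t = product fs
      x = p ⊓ (q ⊓ r)
      2≤x : 2 ≤ x
      2≤x = ⊓-glb (prime⇒1<p p-prime) (⊓-glb (prime⇒1<p q-prime) (prime⇒1<p r-prime))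
      x∣n : x ∣ p * (q * (r * t))
      x∣n = ⊓-closed (_∣ p * (q * (r * t))) (m∣m*n _) (⊓-closed (_∣ p * (q * (r * t)))
              (∣-trans (m∣m*n _) (n∣m*n p)) (∣-trans (m∣m*n t) (∣-trans (n∣m*n q) (n∣m*n p))))
      x³≤n : x * (x * x) ≤ p * (q * (r * t))
      x³≤n = *-mono-≤ (m⊓n≤m p _) (*-mono-≤ (≤-trans (m⊓n≤n p _) (m⊓n≤m q r))
               (≤-trans (≤-trans (m⊓n≤n p _) (m⊓n≤n q r)) (m≤m*n r t {{productOfPrimes≢0 fs-prime}})))

    classify : ∀ {n} → 0 < n → Solution n → n ≤ bound ⊎ SemiprimeSolution n
    classify {n} n>0 = classify-factors factors isFactorisation factorsPrime
      where open PrimeFactorisation (factorise n {{>-nonZero n>0}})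

  LucasSemiprime : ℕ → ℕ → ℕ → Set
  LucasSemiprime p m n =
    ∃ λ k → Prime (u p (double k)) × Prime (u p (double k + double m)) × n ≡ u p (double k) * u p (double k + double m)

  solution-forms : ∀ p m n → 0 < n → σ₂ n ≡ n * n + v p (double m) * n + u p (double m) * u p (double m) + 1 →
            n ≤ (v p (double m) + u p (double m) * u p (double m) + 1) ^ 3 ⊎ LucasSemiprime p m n
  solution-forms p m n n>0 h
    with σ₂-Equation.classify (v p (double m)) (u p (double m) * u p (double m)) (Identities.2≤v-even p m) n>0 h
  ... | inj₁ n≤bound = inj₁ n≤bound
  ... | inj₂ (x , y , x-prime , y-prime , x≢y , n≡xy , x²+y²≡) =
        inj₂ ([ from-pair , from-swapped-pair ]′ (Quadratic.lucas-pair p m x y (prime⇒0<p y-prime) x≢y x²+y²≡))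
    where
    from-pair : LucasPair p m x y → LucasSemiprime p m n
    from-pair (k , x≡ , y≡) = k , subst Prime x≡ x-prime , subst Prime y≡ y-prime , trans n≡xy (cong₂ _*_ x≡ y≡)
    from-swapped-pair : LucasPair p m y x → LucasSemiprime p m n
    from-swapped-pair (k , y≡ , x≡) =
      k , subst Prime y≡ y-prime , subst Prime x≡ x-prime , trans n≡xy (trans (*-comm x y) (cong₂ _*_ y≡ x≡))

-- Integer parameters

open import Defs
open import Data.Nat using (ℕ; zero; suc; _≤_; _<_; _^_; _∸_) renaming (_+_ to _+ℕ_; _*_ to _*ℕ_)
open import Data.Nat.Primality using (Prime)
open import Data.Integer using (ℤ; +_; ∣_∣; _+_; _-_; _*_; -_; -[1+_]; 1ℤ; -1ℤ)
open import Data.Integer.Properties using (pos-+; pos-*; +-injective; -1*i≡-i; neg-involutive; ∣-i∣≡∣i∣; *-identityˡ)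
open import Data.Integer.Tactic.RingSolver using (solve-∀)
import Data.Nat.Properties as ℕ
open import Data.Product using (Σ; _×_; _,_; proj₁)
open import Data.Sum using (_⊎_; inj₁; inj₂)
open import Relation.Binary.PropositionalEquality
open Nonnegative using (u; v; double; double≡2*; double-+)
open import Function using (_∘_)

+-linear : ∀ p a b → + (p *ℕ a +ℕ b) ≡ + p * + a + + b
+-linear p a b = trans (pos-+ (p *ℕ a) b) (cong (_+ + b) (pos-* p a))

recurrence-over-ℕ : ∀ p (s : ℕ → ℤ) (t : ℕ → ℕ) →
                    (∀ n → s (suc (suc n)) ≡ + p * s (suc n) + s n) →
                    (∀ n → t (suc (suc n)) ≡ p *ℕ t (suc n) +ℕ t n) →
                    s 0 ≡ + t 0 → s 1 ≡ + t 1 → ∀ n → s n ≡ + t n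
recurrence-over-ℕ p s t s-rec t-rec s₀ s₁ n = proj₁ (consecutive n)
  where
  consecutive : ∀ n → s n ≡ + t n × s (suc n) ≡ + t (suc n)
  consecutive zero = s₀ , s₁
  consecutive (suc n) with consecutive n
  ... | sₙ , sₙ₊₁ = sₙ₊₁ , (begin
    s (suc (suc n))                  ≡⟨ s-rec n ⟩
    + p * s (suc n) + s n            ≡⟨ cong₂ (λ a b → + p * a + b) sₙ₊₁ sₙ ⟩
    + p * + t (suc n) + + t n        ≡⟨ +-linear p (t (suc n)) (t n) ⟨
    + (p *ℕ t (suc n) +ℕ t n)        ≡⟨ cong +_ (t-rec n) ⟨
    + t (suc (suc n))                ∎)
    where open ≡-Reasoning

recurrence-alternating : ∀ P (s t : ℕ → ℤ) →
                         (∀ n → s (suc (suc n)) ≡ - P * s (suc n) + s n) →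
                         (∀ n → t (suc (suc n)) ≡ P * t (suc n) + t n) →
                         ∀ ε → s 0 ≡ ε * t 0 → s 1 ≡ - (ε * t 1) →
                         ∀ j → s (double j) ≡ ε * t (double j) × s (suc (double j)) ≡ - (ε * t (suc (double j)))
recurrence-alternating P s t s-rec t-rec ε s₀ s₁ zero = s₀ , s₁
recurrence-alternating P s t s-rec t-rec ε s₀ s₁ (suc j) with recurrence-alternating P s t s-rec t-rec ε s₀ s₁ j
... | s₂ⱼ , s₂ⱼ₊₁ = s₂ⱼ₊₂ , (begin
  s (suc (suc (suc e)))                                ≡⟨ s-rec (suc e) ⟩
  - P * s (suc (suc e)) + s (suc e)               ≡⟨ cong₂ (λ a b → - P * a + b) s₂ⱼ₊₂ s₂ⱼ₊₁ ⟩
  - P * (ε * t (suc (suc e))) + - (ε * t (suc e)) ≡⟨ odd-step P ε (t (suc (suc e))) (t (suc e)) ⟩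
  - (ε * (P * t (suc (suc e)) + t (suc e)))      ≡⟨ cong (λ a → - (ε * a)) (t-rec (suc e)) ⟨
  - (ε * t (suc (suc (suc e))))                        ∎)
  where
  open ≡-Reasoning
  e : ℕ
  e = double j
  odd-step : ∀ P ε a b → - P * (ε * a) + - (ε * b) ≡ - (ε * (P * a + b))
  odd-step = solve-∀
  even-step : ∀ P ε a b → - P * - (ε * a) + ε * b ≡ ε * (P * a + b)
  even-step = solve-∀
  s₂ⱼ₊₂ : s (suc (suc e)) ≡ ε * t (suc (suc e))
  s₂ⱼ₊₂ = begin
    s (suc (suc e))                              ≡⟨ s-rec e ⟩
    - P * s (suc e) + s e                 ≡⟨ cong₂ (λ a b → - P * a + b) s₂ⱼ₊₁ s₂ⱼ ⟩
    - P * - (ε * t (suc e)) + ε * t e     ≡⟨ even-step P ε (t (suc e)) (t e) ⟩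
    ε * (P * t (suc e) + t e)             ≡⟨ cong (ε *_) (t-rec e) ⟨
    ε * t (suc (suc e))                          ∎

U⁻-rec : ∀ P n → U⁻ P (suc (suc n)) ≡ P * U⁻ P (suc n) + U⁻ P n
U⁻-rec P n = cong (λ z → P * U⁻ P (suc n) + z) (trans (cong -_ (-1*i≡-i (U⁻ P n))) (neg-involutive (U⁻ P n)))

V⁻-rec : ∀ P n → V⁻ P (suc (suc n)) ≡ P * V⁻ P (suc n) + V⁻ P n
V⁻-rec P n = cong (λ z → P * V⁻ P (suc n) + z) (trans (cong -_ (-1*i≡-i (V⁻ P n))) (neg-involutive (V⁻ P n)))

U⁻-+ : ∀ p n → U⁻ (+ p) n ≡ + u p n
U⁻-+ p = recurrence-over-ℕ p (U⁻ (+ p)) (u p) (U⁻-rec (+ p)) (λ _ → refl) refl refl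

V⁻-+ : ∀ p n → V⁻ (+ p) n ≡ + v p n
V⁻-+ p = recurrence-over-ℕ p (V⁻ (+ p)) (v p) (V⁻-rec (+ p)) (λ _ → refl) refl refl

U⁻-neg-even : ∀ p j → U⁻ (- + p) (double j) ≡ - + u p (double j)
U⁻-neg-even p j = begin
  U⁻ (- + p) (double j)      ≡⟨ proj₁ (recurrence-alternating (+ p) (U⁻ (- + p)) (U⁻ (+ p)) (U⁻-rec (- + p)) (U⁻-rec (+ p))
                                          -1ℤ refl refl j) ⟩
  -1ℤ * U⁻ (+ p) (double j)  ≡⟨ -1*i≡-i _ ⟩
  - U⁻ (+ p) (double j)      ≡⟨ cong -_ (U⁻-+ p (double j)) ⟩
  - + u p (double j)         ∎
  where open ≡-Reasoning

V⁻-neg-even : ∀ p j → V⁻ (- + p) (double j) ≡ + v p (double j)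
V⁻-neg-even p j = begin
  V⁻ (- + p) (double j)      ≡⟨ proj₁ (recurrence-alternating (+ p) (V⁻ (- + p)) (V⁻ (+ p)) (V⁻-rec (- + p)) (V⁻-rec (+ p)) 1ℤ refl
                                          (cong -_ (sym (*-identityˡ (+ p)))) j) ⟩
  1ℤ * V⁻ (+ p) (double j)   ≡⟨ *-identityˡ _ ⟩
  V⁻ (+ p) (double j)        ≡⟨ V⁻-+ p (double j) ⟩
  + v p (double j)           ∎
  where open ≡-Reasoning

V⁻-even : ∀ P j → V⁻ P (double j) ≡ + v (∣ P ∣) (double j)
V⁻-even (+ p) j = V⁻-+ p (double j)
V⁻-even -[1+ q ] j = V⁻-neg-even (suc q) j

∣U⁻-even∣ : ∀ P j → ∣ U⁻ P (double j) ∣ ≡ u (∣ P ∣) (double j)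
∣U⁻-even∣ (+ p) j = cong ∣_∣ (U⁻-+ p (double j))
∣U⁻-even∣ -[1+ q ] j = trans (cong ∣_∣ (U⁻-neg-even (suc q) j)) (∣-i∣≡∣i∣ (+ u (suc q) (double j)))

U⁻*U⁻-even : ∀ P i j → U⁻ P (double i) * U⁻ P (double j) ≡ + (u ∣ P ∣ (double i) *ℕ u (∣ P ∣) (double j))
U⁻*U⁻-even (+ p) i j = trans (cong₂ _*_ (U⁻-+ p (double i)) (U⁻-+ p (double j))) (sym (pos-* (u p (double i)) (u p (double j))))
U⁻*U⁻-even -[1+ q ] i j = begin
  U⁻ (- + p) (double i) * U⁻ (- + p) (double j) ≡⟨ cong₂ _*_ (U⁻-neg-even p i) (U⁻-neg-even p j) ⟩
  - + u p (double i) * - + u p (double j)       ≡⟨ neg*neg (+ u p (double i)) (+ u p (double j)) ⟩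
  + u p (double i) * + u p (double j)           ≡⟨ pos-* (u p (double i)) (u p (double j)) ⟨
  + (u p (double i) *ℕ u p (double j))          ∎
  where
  open ≡-Reasoning
  p : ℕ
  p = suc q
  neg*neg : ∀ a b → - a * - b ≡ a * b
  neg*neg = solve-∀

σ₂-equation-over-ℕ : ∀ P m n → + σ₂ n - + (n ^ 2) ≡ V⁻ P (2 *ℕ m) * + n + U⁻ P (2 *ℕ m) * U⁻ P (2 *ℕ m) + + 1 →
                     σ₂ n ≡ n *ℕ n +ℕ v (∣ P ∣) (double m) *ℕ n +ℕ u (∣ P ∣) (double m) *ℕ u (∣ P ∣) (double m) +ℕ 1
σ₂-equation-over-ℕ P m n h = +-injective (begin
  + σ₂ n                                                      ≡⟨ cancel (+ σ₂ n) (+ (n ^ 2)) ⟩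
  + σ₂ n - + (n ^ 2) + + (n ^ 2)                              ≡⟨ cong₂ _+_ h′ n² ⟩
  V⁻ P (double m) * + n + U⁻ P (double m) * U⁻ P (double m) + + 1 + + n * + n
                                                              ≡⟨ cong₂ (λ a c → a * + n + c + + 1 + + n * + n) (V⁻-even P m) (U⁻*U⁻-even P m m) ⟩
  + a * + n + + c + + 1 + + n * + n                           ≡⟨ regroup (+ a) (+ c) (+ n) ⟩
  + n * + n + + a * + n + + c + + 1                           ≡⟨ embed ⟨
  + (n *ℕ n +ℕ a *ℕ n +ℕ c +ℕ 1)                               ∎)
  where
  open ≡-Reasoning
  a c : ℕ
  a = v (∣ P ∣) (double m)
  c = u (∣ P ∣) (double m) *ℕ u (∣ P ∣) (double m)
  h′ : + σ₂ n - + (n ^ 2) ≡ V⁻ P (double m) * + n + U⁻ P (double m) * U⁻ P (double m) + + 1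
  h′ = subst (λ i → + σ₂ n - + (n ^ 2) ≡ V⁻ P i * + n + U⁻ P i * U⁻ P i + + 1) (sym (double≡2* m)) h
  cancel : ∀ i j → i ≡ i - j + j
  cancel = solve-∀
  regroup : ∀ a c n → a * n + c + + 1 + n * n ≡ n * n + a * n + c + + 1
  regroup = solve-∀
  n² : + (n ^ 2) ≡ + n * + n
  n² = trans (cong (λ t → + (n *ℕ t)) (ℕ.*-identityʳ n)) (pos-* n n)
  embed : + (n *ℕ n +ℕ a *ℕ n +ℕ c +ℕ 1) ≡ + n * + n + + a * + n + + c + + 1
  embed = trans (pos-+ (n *ℕ n +ℕ a *ℕ n +ℕ c) 1) (cong (λ z → z + + 1) (trans (pos-+ (n *ℕ n +ℕ a *ℕ n) c)
            (cong (λ z → z + + c) (trans (pos-+ (n *ℕ n) (a *ℕ n)) (cong₂ _+_ (pos-* n n) (pos-* a n))))))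

bound-over-ℤ : ∀ P m → (v (∣ P ∣) (double m) +ℕ u (∣ P ∣) (double m) *ℕ u (∣ P ∣) (double m) +ℕ 1) ^ 3
                     ≡ (∣ V⁻ P (2 *ℕ m) ∣ +ℕ ∣ U⁻ P (2 *ℕ m) ∣ ^ 2 +ℕ 1) ^ 3
bound-over-ℤ P m = subst (λ i → K ^ 3 ≡ (∣ V⁻ P i ∣ +ℕ ∣ U⁻ P i ∣ ^ 2 +ℕ 1) ^ 3) (double≡2* m)
                     (sym (cong₂ (λ a c → (a +ℕ c +ℕ 1) ^ 3) (cong ∣_∣ (V⁻-even P m)) ∣U⁻∣²))
  where
  K : ℕ
  K = v (∣ P ∣) (double m) +ℕ u (∣ P ∣) (double m) *ℕ u (∣ P ∣) (double m) +ℕ 1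
  ∣U⁻∣² : ∣ U⁻ P (double m) ∣ ^ 2 ≡ u (∣ P ∣) (double m) *ℕ u (∣ P ∣) (double m)
  ∣U⁻∣² = trans (cong (∣ U⁻ P (double m) ∣ *ℕ_) (ℕ.*-identityʳ _)) (cong₂ _*ℕ_ (∣U⁻-even∣ P m) (∣U⁻-even∣ P m))

lucas-semiprime-over-ℤ : ∀ P m n → Nonnegative.LucasSemiprime (∣ P ∣) m n →
                         Σ ℕ (λ k → Prime ∣ U⁻ P (2 *ℕ k) ∣ × Prime ∣ U⁻ P (2 *ℕ k +ℕ 2 *ℕ m) ∣
                                  × + n ≡ U⁻ P (2 *ℕ k) * U⁻ P (2 *ℕ k +ℕ 2 *ℕ m))
lucas-semiprime-over-ℤ P m n (k , prime₁ , prime₂ , n≡) =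
  k , subst₂ LucasSemiprimeℤ (double≡2* k) (trans (double-+ k m) (cong₂ _+ℕ_ (double≡2* k) (double≡2* m)))
        (subst Prime (sym (∣U⁻-even∣ P k)) prime₁ ,
         subst Prime (sym (∣U⁻-even∣ P (k +ℕ m))) (subst (Prime ∘ u (∣ P ∣)) (sym (double-+ k m)) prime₂) ,
         trans (cong +_ (trans n≡ (cong (λ i → u (∣ P ∣) (double k) *ℕ u (∣ P ∣) i) (sym (double-+ k m)))))
               (sym (U⁻*U⁻-even P k (k +ℕ m))))
  where
  LucasSemiprimeℤ : ℕ → ℕ → Set
  LucasSemiprimeℤ i j = Prime ∣ U⁻ P i ∣ × Prime ∣ U⁻ P j ∣ × + n ≡ U⁻ P i * U⁻ P j

theorem1p4 : (P : ℤ) (m : ℕ) (n : ℕ) → 0 < n →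
    + σ₂ n - + (n ^ 2) ≡ V⁻ P (2 *ℕ m) * + n + U⁻ P (2 *ℕ m) * U⁻ P (2 *ℕ m) + + 1 →
    (n ≤ (∣ V⁻ P (2 *ℕ m) ∣ +ℕ ∣ U⁻ P (2 *ℕ m) ∣ ^ 2 +ℕ 1) ^ 3)
    ⊎ (Σ ℕ (λ k → Prime ∣ U⁻ P (2 *ℕ k) ∣ × Prime ∣ U⁻ P (2 *ℕ k +ℕ 2 *ℕ m) ∣
          × + n ≡ U⁻ P (2 *ℕ k) * U⁻ P (2 *ℕ k +ℕ 2 *ℕ m)))
    ⊎ (Σ ℕ (λ k → 2 *ℕ k ≤ 2 *ℕ m × m ≢ 2 *ℕ k
          × Prime ∣ U⁻ P (2 *ℕ k) ∣ × Prime ∣ U⁻ P (2 *ℕ m ∸ 2 *ℕ k) ∣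
          × + n ≡ U⁻ P (2 *ℕ k) * U⁻ P (2 *ℕ m ∸ 2 *ℕ k)))
theorem1p4 P m n n>0 h with Nonnegative.solution-forms ∣ P ∣ m n n>0 (σ₂-equation-over-ℕ P m n h)
... | inj₁ n≤bound = inj₁ (subst (n ≤_) (bound-over-ℤ P m) n≤bound)
... | inj₂ semiprime = inj₂ (inj₁ (lucas-semiprime-over-ℤ P m n semiprime))
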